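{- For every $n\ge 1$, the friendship graph $f_n$ is distance antimagic.
   Context: The friendship graph $f_n$ is obtained by identifying one vertex from each of $n$ copies of the triangle $K_3$; it has $2n+1$ vertices. For a graph $G$ with $v$ vertices, a distance antimagic labeling is a bijection $f:V(G)\to\{1,\ldots,v\}$ such that the vertex-weights $w(x)=\sum_{y\in N(x)} f(y)$ ($N(x)$ the set of neighbors of $x$) are pairwise distinct; $G$ is distance antimagic if it admits such a labeling. -}

module Defs where

open import Data.Nat using (ℕ; zero; suc; _+_; _*_; _≡ᵇ_)
open import Data.Fin using (Fin; toℕ)
open import Data.Bool using (Bool; true; false; _∧_; _∨_; not; if_then_else_)
open import Data.Vec.Functional using (foldr)
open import Data.Product using (Σ; _×_)
open import Function.Definitions using (Injective; Bijective)
open import Relation.Binary.PropositionalEquality using (_≡_)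

record Graph : Set where
  field
    order : ℕ
    adj   : Fin order → Fin order → Bool

open Graph public

sumFin : {v : ℕ} → (Fin v → ℕ) → ℕ
sumFin f = foldr _+_ 0 f

-- A labeling f : Fin v → Fin v (a bijection, see below) assigns to
-- vertex y the label toℕ (f y) + 1 ∈ {1,…,v}.
label : {v : ℕ} → (Fin v → Fin v) → Fin v → ℕ
label f y = suc (toℕ (f y))

weight : (G : Graph) → (Fin (order G) → Fin (order G)) → Fin (order G) → ℕ
weight G f x = sumFin (λ y → if adj G x y then label f y else 0)

IsDistanceAntimagicLabeling : (G : Graph) → (Fin (order G) → Fin (order G)) → Set
IsDistanceAntimagicLabeling G f = Bijective _≡_ _≡_ f × Injective _≡_ _≡_ (weight G f)

DistanceAntimagic : Graph → Set
DistanceAntimagic G = Σ (Fin (order G) → Fin (order G)) (IsDistanceAntimagicLabeling G)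

-- Vertex 0 is the common
-- (centre) vertex; for i < n, vertices 2i+1 and 2i+2 together with 0
-- form the i-th triangle.  Two distinct vertices x, y are adjacent iff
-- one of them is the centre or they lie in the same triangle, i.e.
-- (x-1)/2 = (y-1)/2 (both non-zero).
blade : ℕ → ℕ
blade zero = 0
blade (suc zero) = 0
blade (suc (suc k)) = suc (blade k)

-- triangle index of a non-centre vertex m+1 is blade m = m / 2
friendAdjℕ : ℕ → ℕ → Bool
friendAdjℕ zero zero = false
friendAdjℕ zero (suc _) = true
friendAdjℕ (suc _) zero = true
friendAdjℕ (suc a) (suc b) = not (a ≡ᵇ b) ∧ (blade a ≡ᵇ blade b)

friendship : ℕ → Graph
friendship n = record
  { order = suc (2 * n)
  ; adj   = λ x y → friendAdjℕ (toℕ x) (toℕ y)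
  }

-- Label every vertex by its own index (label y = y + 1).  A non-centre
-- vertex x is adjacent only to the centre (label 1) and to its partner in
-- the same triangle, so its weight is 1 + label(partner x); as "partner" is
-- an involution these weights are pairwise distinct.  The centre is adjacent
-- to both x and partner x, so its weight is at least
-- label(x) + label(partner x) > 1 + label(partner x), more than any other.
module Submission where

open import Defs
open import Data.Nat using (ℕ; zero; suc; _+_; _*_; _≤_; _<_; _≥_; z≤n; s≤s)
open import Data.Nat.Properties
  using ( +-identityʳ; +-comm; +-mono-≤; +-cancelˡ-≡; *-suc; suc-injective
        ; m≤n+m; m≤m+n; ≤-refl; ≤-reflexive; ≤-trans; <-irrefl; module ≤-Reasoning)
open import Data.Fin using (Fin; toℕ; fromℕ<) renaming (zero to fzero; suc to fsuc)
open import Data.Fin.Properties using (toℕ<n; toℕ-fromℕ<; toℕ-injective)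
  renaming (suc-injective to fsuc-injective)
open import Data.Bool using (true; false; if_then_else_)
open import Data.Product using (_,_)
open import Data.Empty using (⊥-elim)
open import Function using (id; _∘_)
open import Function.Construct.Identity using (bijective)
open import Function.Definitions using (Injective)
open import Relation.Binary.PropositionalEquality

sumFin-zero : ∀ {v} (f : Fin v → ℕ) → (∀ y → f y ≡ 0) → sumFin f ≡ 0
sumFin-zero {zero}  f f≡0 = refl
sumFin-zero {suc v} f f≡0 = cong₂ _+_ (f≡0 fzero) (sumFin-zero (f ∘ fsuc) (f≡0 ∘ fsuc))

sumFin-single : ∀ {v} (f : Fin v → ℕ) (p : Fin v) →
                (∀ y → y ≢ p → f y ≡ 0) → sumFin f ≡ f p
sumFin-single f fzero f≡0 = begin
  f fzero + sumFin (f ∘ fsuc)  ≡⟨ cong (f fzero +_) (sumFin-zero _ (λ y → f≡0 (fsuc y) λ ())) ⟩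
  f fzero + 0                  ≡⟨ +-identityʳ _ ⟩
  f fzero                      ∎
  where open ≡-Reasoning
sumFin-single f (fsuc p) f≡0 =
  cong₂ _+_ (f≡0 fzero λ ())
            (sumFin-single (f ∘ fsuc) p (λ y y≢p → f≡0 (fsuc y) (y≢p ∘ fsuc-injective)))

sumFin-≥-term : ∀ {v} (f : Fin v → ℕ) (p : Fin v) → f p ≤ sumFin f
sumFin-≥-term f fzero    = m≤m+n (f fzero) _
sumFin-≥-term f (fsuc p) = ≤-trans (sumFin-≥-term (f ∘ fsuc) p) (m≤n+m _ (f fzero))

sumFin-≥-pair : ∀ {v} (f : Fin v → ℕ) {p q : Fin v} → p ≢ q → f p + f q ≤ sumFin f
sumFin-≥-pair f {fzero}  {fzero}  p≢q = ⊥-elim (p≢q refl)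
sumFin-≥-pair f {fzero}  {fsuc q} p≢q = +-mono-≤ ≤-refl (sumFin-≥-term (f ∘ fsuc) q)
sumFin-≥-pair f {fsuc p} {fzero}  p≢q =
  subst (_≤ sumFin f) (+-comm (f fzero) _) (+-mono-≤ ≤-refl (sumFin-≥-term (f ∘ fsuc) p))
sumFin-≥-pair f {fsuc p} {fsuc q} p≢q =
  ≤-trans (sumFin-≥-pair (f ∘ fsuc) (p≢q ∘ cong fsuc)) (m≤n+m _ (f fzero))

-- For a non-centre vertex 1 + b, the other non-centre vertex of its
-- triangle is 1 + partner b.
partner : ℕ → ℕ
partner zero          = 1
partner (suc zero)    = 0
partner (suc (suc b)) = suc (suc (partner b))

partner-involutive : ∀ b → partner (partner b) ≡ b
partner-involutive zero          = refl
partner-involutive (suc zero)    = refl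
partner-involutive (suc (suc b)) = cong (suc ∘ suc) (partner-involutive b)

partner-injective : ∀ {b c} → partner b ≡ partner c → b ≡ c
partner-injective {b} {c} eq = begin
  b                    ≡⟨ partner-involutive b ⟨
  partner (partner b)  ≡⟨ cong partner eq ⟩
  partner (partner c)  ≡⟨ partner-involutive c ⟩
  c                    ∎
  where open ≡-Reasoning

partner-≢ : ∀ b → b ≢ partner b
partner-≢ (suc (suc b)) eq = partner-≢ b (suc-injective (suc-injective eq))

partner-< : ∀ m {b} → b < 2 * m → partner b < 2 * m
partner-< zero    ()
partner-< (suc m) {b} b<2m+2 =
  subst (partner b <_) (sym (*-suc 2 m)) (go b (subst (b <_) (*-suc 2 m) b<2m+2))
  where
  go : ∀ b → b < 2 + 2 * m → partner b < 2 + 2 * m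
  go zero          _                = s≤s (s≤s z≤n)
  go (suc zero)    _                = s≤s z≤n
  go (suc (suc b)) (s≤s (s≤s b<2m)) = s≤s (s≤s (partner-< m b<2m))

friendAdj-partner : ∀ b → friendAdjℕ (suc b) (suc (partner b)) ≡ true
friendAdj-partner zero          = refl
friendAdj-partner (suc zero)    = refl
friendAdj-partner (suc (suc b)) = friendAdj-partner b

friendAdj⇒partner : ∀ b c → friendAdjℕ (suc b) (suc c) ≡ true → c ≡ partner b
friendAdj⇒partner zero          (suc zero)    _   = refl
friendAdj⇒partner (suc zero)    zero          _   = refl
friendAdj⇒partner (suc zero)    (suc zero)    ()
friendAdj⇒partner (suc zero)    (suc (suc c)) ()
friendAdj⇒partner (suc (suc b)) (suc (suc c)) adj = cong (suc ∘ suc) (friendAdj⇒partner b c adj)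

partnerFin : ∀ n → Fin (2 * n) → Fin (2 * n)
partnerFin n x = fromℕ< (partner-< n (toℕ<n x))

toℕ-partnerFin : ∀ n (x : Fin (2 * n)) → toℕ (partnerFin n x) ≡ partner (toℕ x)
toℕ-partnerFin n x = toℕ-fromℕ< _

identityWeight : (n : ℕ) → Fin (suc (2 * n)) → ℕ
identityWeight n = weight (friendship n) id

identityWeight-blade : ∀ n (x : Fin (2 * n)) → identityWeight n (fsuc x) ≡ 3 + partner (toℕ x)
identityWeight-blade n x =
  cong suc (trans (sumFin-single neighbour (partnerFin n x) off-partner) at-partner)
  where
  b = toℕ x
  neighbour : Fin (2 * n) → ℕ
  neighbour z = if friendAdjℕ (suc b) (suc (toℕ z)) then suc (suc (toℕ z)) else 0

  off-partner : ∀ z → z ≢ partnerFin n x → neighbour z ≡ 0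
  off-partner z z≢p with friendAdjℕ (suc b) (suc (toℕ z)) in adj
  ... | true  = ⊥-elim (z≢p (toℕ-injective
                  (trans (friendAdj⇒partner b (toℕ z) adj) (sym (toℕ-partnerFin n x)))))
  ... | false = refl

  at-partner : neighbour (partnerFin n x) ≡ suc (suc (partner b))
  at-partner rewrite toℕ-partnerFin n x | friendAdj-partner b = refl

identityWeight-centre : ∀ n (x : Fin (2 * n)) → identityWeight n (fsuc x) < identityWeight n fzero
identityWeight-centre n x = begin-strict
  identityWeight n (fsuc x)                 ≡⟨ identityWeight-blade n x ⟩
  3 + partner (toℕ x)                       <⟨ +-mono-≤ (s≤s (s≤s z≤n)) 2+partner≤ ⟩
  (2 + toℕ x) + (2 + toℕ (partnerFin n x))  ≤⟨ sumFin-≥-pair centreTerm fsuc-x≢fsuc-partner ⟩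
  identityWeight n fzero                    ∎
  where
  open ≤-Reasoning
  centreTerm : Fin (suc (2 * n)) → ℕ
  centreTerm y = if friendAdjℕ 0 (toℕ y) then suc (toℕ y) else 0
  2+partner≤ : 2 + partner (toℕ x) ≤ 2 + toℕ (partnerFin n x)
  2+partner≤ = ≤-reflexive (cong (2 +_) (sym (toℕ-partnerFin n x)))
  fsuc-x≢fsuc-partner : fsuc x ≢ fsuc (partnerFin n x)
  fsuc-x≢fsuc-partner eq =
    partner-≢ (toℕ x) (trans (cong toℕ (fsuc-injective eq)) (toℕ-partnerFin n x))

identityWeight-injective : ∀ n → Injective _≡_ _≡_ (identityWeight n)
identityWeight-injective n {fzero}  {fzero}  _  = refl
identityWeight-injective n {fzero}  {fsuc y} eq =
  ⊥-elim (<-irrefl (sym eq) (identityWeight-centre n y))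
identityWeight-injective n {fsuc x} {fzero}  eq =
  ⊥-elim (<-irrefl eq (identityWeight-centre n x))
identityWeight-injective n {fsuc x} {fsuc y} eq =
  cong fsuc (toℕ-injective (partner-injective (+-cancelˡ-≡ 3 _ _
    (trans (sym (identityWeight-blade n x)) (trans eq (identityWeight-blade n y))))))

mainTheorem15 : (n : ℕ) → n ≥ 1 → DistanceAntimagic (friendship n)
mainTheorem15 n _ = id , bijective _≡_ , identityWeight-injective n
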